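{- Let $E:\mathbb{N}\to\mathbb{N}$, $E(x)=4x-1$, with $E^0$ the identity and $E^n=E\circ E^{n-1}$. Then the sets $E^n(\{2+2m: m\in\mathbb{N}_0\})$ and $E^n(\{1+4m: m\in\mathbb{N}_0\})$, for $n\in\mathbb{N}_0$, form a partition of $\mathbb{N}$: they are pairwise disjoint and their union is $\mathbb{N}$.
   Context: $\mathbb{N}=\{1,2,3,\dots\}$, $\mathbb{N}_0=\{0\}\cup\mathbb{N}$. -}

module Defs where

open import Data.Nat using (ℕ; zero; suc; _+_; _*_; _∸_)
open import Data.Bool using (Bool; true; false)
open import Data.Product using (∃; ∃-syntax; _×_)
open import Relation.Binary.PropositionalEquality using (_≡_)

-- E(x) = 4x - 1  (as a map ℕ → ℕ on positive naturals; on 0 truncated subtraction gives 0,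
-- which never matters since all arguments used are positive)
E : ℕ → ℕ
E x = 4 * x ∸ 1

E^ : ℕ → ℕ → ℕ
E^ zero    x = x
E^ (suc n) x = E (E^ n x)

base : Bool → ℕ → ℕ
base false m = 2 + 2 * m
base true  m = 1 + 4 * m

InPart : ℕ → Bool → ℕ → Set
InPart n b x = ∃[ m ] x ≡ E^ n (base b m)

{-# OPTIONS --safe #-}
module Submission where

-- Every positive number is either even (of the form 2 + 2m), or 1 mod 4 (of the form 1 + 4m),
-- or 3 mod 4, and a number 3 + 4k is E (k + 1) for the strictly smaller positive number k + 1.
-- Peeling off E while the number is 3 mod 4 therefore ends, after n steps, in one of the two
-- base families.  The three residue classes are disjoint and E is injective, so both the number
-- of steps n and the family reached are determined by the starting number.

open import Defs
open import Data.Nat using (ℕ; zero; suc; _+_; _*_; _∸_; _≤_; _<_; z≤n; s≤s; NonZero)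
open import Data.Nat.Properties
open import Data.Nat.DivMod using (_%_; _/_; m≡m%n+[m/n]*n; m%n<n; [m+kn]%n≡m%n; m<n⇒m%n≡m)
open import Data.Nat.Induction using (<-rec)
open import Data.Nat.Tactic.RingSolver using (solve-∀)
open import Data.Bool using (Bool; true; false)
open import Data.Product using (∃; ∃-syntax; _×_; _,_; map₁)
open import Data.Empty using (⊥-elim)
open import Relation.Binary.PropositionalEquality

residue-unique : ∀ n .{{_ : NonZero n}} {r r′} q q′ → r < n → r′ < n →
                 r + n * q ≡ r′ + n * q′ → r ≡ r′
residue-unique n {r} {r′} q q′ r<n r′<n eq = begin
  r                 ≡⟨ m<n⇒m%n≡m r<n ⟨
  r % n             ≡⟨ [m+kn]%n≡m%n r q n ⟨
  (r + q * n) % n   ≡⟨ cong (λ t → (r + t) % n) (*-comm q n) ⟩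
  (r + n * q) % n   ≡⟨ cong (_% n) eq ⟩
  (r′ + n * q′) % n ≡⟨ cong (λ t → (r′ + t) % n) (*-comm n q′) ⟩
  (r′ + q′ * n) % n ≡⟨ [m+kn]%n≡m%n r′ q′ n ⟩
  r′ % n            ≡⟨ m<n⇒m%n≡m r′<n ⟩
  r′                ∎
  where open ≡-Reasoning

E-suc : ∀ k → E (suc k) ≡ 3 + 4 * k
E-suc k = cong (_∸ 1) (*-distribˡ-+ 4 1 k)

E-injective : ∀ {x y} → E x ≡ E y → x ≡ y
E-injective {zero}  {zero}  _  = refl
E-injective {zero}  {suc y} eq with () ← trans eq (E-suc y)
E-injective {suc x} {zero}  eq with () ← trans (sym (E-suc x)) eq
E-injective {suc x} {suc y} eq =
  cong suc (*-cancelˡ-≡ x y 4 (+-cancelˡ-≡ 3 _ _ (trans (sym (E-suc x)) (trans eq (E-suc y)))))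

suc<E-suc : ∀ k → suc k < E (suc k)
suc<E-suc k rewrite E-suc k = s≤s (s≤s (≤-trans (m≤n*m k 4) (m≤n+m (4 * k) 1)))

E-pos : ∀ {x} → 1 ≤ x → 1 ≤ E x
E-pos {suc k} _ rewrite E-suc k = s≤s z≤n

E^-pos : ∀ n {x} → 1 ≤ x → 1 ≤ E^ n x
E^-pos zero    1≤x = 1≤x
E^-pos (suc n) 1≤x = E-pos (E^-pos n 1≤x)

base-pos : ∀ b m → 1 ≤ base b m
base-pos false m = s≤s z≤n
base-pos true  m = s≤s z≤n

InPart-pos : ∀ n b x → InPart n b x → 1 ≤ x
InPart-pos n b x (m , refl) = E^-pos n (base-pos b m)

InPart-E : ∀ {n b x} → InPart n b x → InPart (suc n) b (E x)
InPart-E (m , eq) = m , cong E eq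

base-false≢base-true : ∀ m m′ → base false m ≢ base true m′
base-false≢base-true m m′ eq = even≢odd (suc m) (2 * m′) (trans (even m) (trans eq (odd m′)))
  where
  even : ∀ m → 2 * suc m ≡ 2 + 2 * m
  even = solve-∀
  odd : ∀ m → 1 + 4 * m ≡ suc (2 * (2 * m))
  odd = solve-∀

base-tag-injective : ∀ {b b′ m m′} → base b m ≡ base b′ m′ → b ≡ b′
base-tag-injective {false} {false}         _  = refl
base-tag-injective {true}  {true}          _  = refl
base-tag-injective {false} {true}  {m} {m′} eq = ⊥-elim (base-false≢base-true m m′ eq)
base-tag-injective {true}  {false} {m} {m′} eq = ⊥-elim (base-false≢base-true m′ m (sym eq))

base≢E : ∀ {b m y} → 1 ≤ y → base b m ≢ E y
base≢E {false} {m} {suc k} _ eq =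
  even≢odd (suc m) (suc (2 * k)) (trans (even m) (trans eq (trans (E-suc k) (odd k))))
  where
  even : ∀ m → 2 * suc m ≡ 2 + 2 * m
  even = solve-∀
  odd : ∀ k → 3 + 4 * k ≡ suc (2 * suc (2 * k))
  odd = solve-∀
base≢E {true}  {m} {suc k} _ eq
  with () ← residue-unique 4 {1} {3} m k (s≤s (s≤s z≤n)) (n<1+n 3) (trans eq (E-suc k))

E^-base-injective : ∀ n n′ {b b′ m m′} →
                    E^ n (base b m) ≡ E^ n′ (base b′ m′) → (n ≡ n′) × (b ≡ b′)
E^-base-injective zero    zero     eq = refl , base-tag-injective eq
E^-base-injective zero    (suc n′) {b} {b′} {m} {m′} eq =
  ⊥-elim (base≢E {b} {m} (E^-pos n′ (base-pos b′ m′)) eq)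
E^-base-injective (suc n) zero     {b} {b′} {m} {m′} eq =
  ⊥-elim (base≢E {b′} {m′} (E^-pos n (base-pos b m)) (sym eq))
E^-base-injective (suc n) (suc n′) eq = map₁ (cong suc) (E^-base-injective n n′ (E-injective eq))

InPart-disjoint : ∀ {n n′ b b′ x} → InPart n b x → InPart n′ b′ x → (n ≡ n′) × (b ≡ b′)
InPart-disjoint {n} {n′} (m , refl) (m′ , eq) = E^-base-injective n n′ eq

data Shape (x : ℕ) : Set where
  at-base : ∀ b m → x ≡ base b m → Shape x
  at-E    : ∀ k → x ≡ E (suc k) → Shape x

shape : ∀ x → 1 ≤ x → Shape x
shape x 1≤x with x % 4 | m%n<n x 4 | m≡m%n+[m/n]*n x 4
... | 0 | _ | eq with x / 4
...   | zero  = ⊥-elim (<-irrefl (sym eq) 1≤x)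
...   | suc q = at-base false (1 + 2 * q) (trans eq (four q))
  where
  four : ∀ q → 0 + suc q * 4 ≡ 2 + 2 * (1 + 2 * q)
  four = solve-∀
shape x 1≤x | 1 | _ | eq = at-base true (x / 4) (trans eq (one (x / 4)))
  where
  one : ∀ q → 1 + q * 4 ≡ 1 + 4 * q
  one = solve-∀
shape x 1≤x | 2 | _ | eq = at-base false (2 * (x / 4)) (trans eq (two (x / 4)))
  where
  two : ∀ q → 2 + q * 4 ≡ 2 + 2 * (2 * q)
  two = solve-∀
shape x 1≤x | 3 | _ | eq = at-E (x / 4) (trans eq (three (x / 4)))
  where
  three : ∀ q → 3 + q * 4 ≡ E (suc q)
  three q = trans (cong (3 +_) (*-comm q 4)) (sym (E-suc q))
shape x 1≤x | suc (suc (suc (suc _))) | s≤s (s≤s (s≤s (s≤s ()))) | _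

Covered : ℕ → Set
Covered x = ∃[ n ] ∃[ b ] InPart n b x

cover : ∀ x → 1 ≤ x → Covered x
cover = <-rec (λ x → 1 ≤ x → Covered x) step
  where
  step : ∀ x → (∀ {y} → y < x → 1 ≤ y → Covered y) → 1 ≤ x → Covered x
  step x rec 1≤x with shape x 1≤x
  ... | at-base b m eq = 0 , b , m , eq
  ... | at-E k refl with rec (suc<E-suc k) (s≤s z≤n)
  ...   | n , b , p = suc n , b , InPart-E {n} {b} p

lemma13 : ((x : ℕ) → 1 ≤ x → ∃[ n ] ∃[ b ] InPart n b x)
          × ((n : ℕ) (b : Bool) (x : ℕ) → InPart n b x → 1 ≤ x)
          × ((n n′ : ℕ) (b b′ : Bool) (x : ℕ) → InPart n b x → InPart n′ b′ x → (n ≡ n′) × (b ≡ b′))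
lemma13 = cover , InPart-pos , λ _ _ _ _ _ → InPart-disjoint
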